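{- Let $\Sigma$ be a finite connected bipartite graph and let $\Gamma=\mathsf{S}(\Sigma)$ be its subdivision graph. Then $\mathrm{diam}(\Gamma)=2\,\mathrm{diam}(\Sigma)$.
   Context: The subdivision graph $\mathsf{S}(\Sigma)$ has vertex set $V\Sigma\cup E\Sigma$ and edges $\{x,e\}$ with $x\in V\Sigma$, $e\in E\Sigma$, $x\in e$. -}

module Defs where

open import Data.Nat using (ℕ; zero; suc; _≤_; _<_)
open import Data.Fin using (Fin; toℕ)
open import Data.Bool using (Bool; T)
open import Data.Sum using (_⊎_; inj₁; inj₂)
open import Data.Product using (Σ; Σ-syntax; ∃; ∃-syntax; _×_; _,_)
open import Data.Empty using (⊥)
open import Relation.Binary.PropositionalEquality using (_≡_; _≢_)

data Walk {V : Set} (R : V → V → Set) : V → V → ℕ → Set where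
  nil  : ∀ {x} → Walk R x x 0
  cons : ∀ {x y z k} → R x y → Walk R y z k → Walk R x z (suc k)

Connected : {V : Set} → (V → V → Set) → Set
Connected {V} R = ∀ (x y : V) → ∃[ k ] Walk R x y k

IsDist : {V : Set} → (V → V → Set) → V → V → ℕ → Set
IsDist R x y d = Walk R x y d × (∀ k → Walk R x y k → d ≤ k)

IsDiam : {V : Set} → (V → V → Set) → ℕ → Set
IsDiam {V} R D =
  (∀ (x y : V) → ∃[ d ] (d ≤ D × IsDist R x y d))
  × (∃[ x ] ∃[ y ] IsDist R x y D)

record SimpleGraph (n : ℕ) : Set where
  field
    adj     : Fin n → Fin n → Bool
    adj-sym : ∀ i j → adj i j ≡ adj j i
    irrefl  : ∀ i → T (adj i i) → ⊥

  Adj : Fin n → Fin n → Set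
  Adj i j = T (adj i j)

  -- an edge {i,j} is represented once, with toℕ i < toℕ j
  Edge : Set
  Edge = Σ[ i ∈ Fin n ] Σ[ j ∈ Fin n ] (toℕ i < toℕ j × Adj i j)

open SimpleGraph public

Bipartite : ∀ {n} → SimpleGraph n → Set
Bipartite {n} G = Σ[ c ∈ (Fin n → Bool) ] (∀ (i j : Fin n) → Adj G i j → c i ≢ c j)

_∈E_ : ∀ {n} {G : SimpleGraph n} → Fin n → Edge G → Set
x ∈E (i , j , _) = x ≡ i ⊎ x ≡ j

-- Subdivision graph S(G): vertices V ⊎ E, edges {x,e} with x ∈ e
SVertex : ∀ {n} → SimpleGraph n → Set
SVertex {n} G = Fin n ⊎ Edge G

SAdj : ∀ {n} (G : SimpleGraph n) → SVertex G → SVertex G → Set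
SAdj G (inj₁ x) (inj₁ y) = ⊥
SAdj G (inj₁ x) (inj₂ e) = _∈E_ {G = G} x e
SAdj G (inj₂ e) (inj₁ x) = _∈E_ {G = G} x e
SAdj G (inj₂ e) (inj₂ f) = ⊥

-- A walk in Σ between vertices x and y lifts to a walk of twice the length in S(Σ), and every
-- S(Σ)-walk between x and y contracts to a Σ-walk of at most half its length; so distances between
-- original vertices double.  An edge {i,j} lies at distance 1 + 2 min(d(i,x), d(j,x)) from x, and
-- since Σ is bipartite d(i,x) and d(j,x) have different parities, hence are distinct, so the
-- minimum is below diam Σ and the distance is at most 2 diam Σ - 1.  Two distinct edges are then
-- at distance at most 2 diam Σ through an endpoint of the first.
module Submission where

open import Defs
open import Data.Nat using (ℕ; _*_; zero; suc; _+_; _≤_; z≤n; s≤s; _⊓_)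
open import Data.Nat.Properties
  using (≤-trans; n≤1+n; <-cmp; <-irrelevant; ⊓-sel; m⊓n≤m; m⊓n≤n; m≤n⇒m<n∨m≡n; +-comm; +-suc)
open import Data.Nat.GeneralisedArithmetic using (iterate)
open import Data.Fin using (Fin; toℕ)
open import Data.Fin.Properties using (toℕ-injective) renaming (_≟_ to _≟F_)
open import Data.Bool using (Bool; not; T)
open import Data.Bool.Properties using (T-irrelevant; ¬-not; not-injective)
open import Data.Sum using (_⊎_; inj₁; inj₂)
open import Data.Product using (Σ-syntax; ∃-syntax; _×_; _,_; proj₁; proj₂)
open import Data.Product.Properties using (≡-dec)
open import Data.Empty using (⊥-elim)
open import Relation.Nullary using (¬_; yes; no)
open import Relation.Binary using (DecidableEquality; tri<; tri≈; tri>)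
open import Function using (_∘_)
open import Relation.Binary.PropositionalEquality

double : ℕ → ℕ
double zero    = zero
double (suc m) = suc (suc (double m))

double-mono : ∀ {m n} → m ≤ n → double m ≤ double n
double-mono z≤n     = z≤n
double-mono (s≤s p) = s≤s (s≤s (double-mono p))

double≡2* : ∀ m → double m ≡ 2 * m
double≡2* zero    = refl
double≡2* (suc m) = cong suc (trans (cong suc (double≡2* m)) (sym (+-suc m (m + 0))))

double-⊓-<-double : ∀ {a b D} → a ≤ D → b ≤ D → a ≢ b →
                    suc (suc (double a ⊓ double b)) ≤ double D
double-⊓-<-double {a} {b} a≤D b≤D a≢b with m≤n⇒m<n∨m≡n a≤D | m≤n⇒m<n∨m≡n b≤D
... | inj₁ a<D | _        = ≤-trans (s≤s (s≤s (m⊓n≤m _ _))) (double-mono a<D)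
... | inj₂ _   | inj₁ b<D = ≤-trans (s≤s (s≤s (m⊓n≤n _ _))) (double-mono b<D)
... | inj₂ a≡D | inj₂ b≡D = ⊥-elim (a≢b (trans a≡D (sym b≡D)))

module _ {V : Set} {R : V → V → Set} where

  _++_ : ∀ {x y z a b} → Walk R x y a → Walk R y z b → Walk R x z (a + b)
  nil      ++ w = w
  cons r v ++ w = cons r (v ++ w)

  module _ (R-sym : ∀ {x y} → R x y → R y x) where

    reverse : ∀ {x y k} → Walk R x y k → Walk R y x k
    reverse nil                = nil
    reverse (cons {k = k} r w) =
      subst (Walk R _ _) (+-comm k 1) (reverse w ++ cons (R-sym r) nil)

    IsDist-sym : ∀ {x y d} → IsDist R x y d → IsDist R y x d
    IsDist-sym (w , minimal) = reverse w , λ k w′ → minimal k (reverse w′)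

  IsDist-through-two-neighbours :
    ∀ {u a b v da db} → R u a → R u b → (∀ {w} → R u w → w ≡ a ⊎ w ≡ b) → u ≢ v →
    IsDist R a v da → IsDist R b v db → IsDist R u v (suc (da ⊓ db))
  IsDist-through-two-neighbours {da = da} {db} ua ub neighbours u≢v (wa , mina) (wb , minb) =
    walk , minimal
    where
      walk : Walk R _ _ (suc (da ⊓ db))
      walk with ⊓-sel da db
      ... | inj₁ eq rewrite eq = cons ua wa
      ... | inj₂ eq rewrite eq = cons ub wb

      minimal : ∀ k → Walk R _ _ k → suc (da ⊓ db) ≤ k
      minimal _ nil = ⊥-elim (u≢v refl)
      minimal _ (cons {k = k} r w) with neighbours r
      ... | inj₁ refl = s≤s (≤-trans (m⊓n≤m da db) (mina k w))
      ... | inj₂ refl = s≤s (≤-trans (m⊓n≤n da db) (minb k w))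

  module _ (c : V → Bool) (proper : ∀ {x y} → R x y → c x ≢ c y) where

    walk-colour : ∀ {x y k} → Walk R x y k → c y ≡ iterate not (c x) k
    walk-colour nil                = refl
    walk-colour (cons {k = k} r w) =
      trans (walk-colour w) (cong (λ b → iterate not b k) (¬-not (proper r ∘ sym)))

    equal-length-walks⇒¬adjacent : ∀ {i j x k} → Walk R i x k → Walk R j x k → ¬ R i j
    equal-length-walks⇒¬adjacent {k = k} wi wj r =
      proper r (iterate-not-injective k (trans (sym (walk-colour wi)) (walk-colour wj)))
      where
        iterate-not-injective : ∀ {b b′} k → iterate not b k ≡ iterate not b′ k → b ≡ b′
        iterate-not-injective zero    eq = eq
        iterate-not-injective (suc k) eq = not-injective (iterate-not-injective k eq)

module Subdivision {n : ℕ} (G : SimpleGraph n) where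

  A = Adj G
  S = SAdj G

  _∈e_ : Fin n → Edge G → Set
  x ∈e e = _∈E_ {G = G} x e

  A-sym : ∀ {x y} → A x y → A y x
  A-sym {x} {y} = subst T (adj-sym G x y)

  S-sym : ∀ {u v} → S u v → S v u
  S-sym {inj₁ _} {inj₂ _} r = r
  S-sym {inj₂ _} {inj₁ _} r = r

  _≟E_ : DecidableEquality (Edge G)
  _≟E_ = ≡-dec _≟F_ (≡-dec _≟F_ λ _ _ →
           yes (cong₂ _,_ (<-irrelevant _ _) (T-irrelevant _ _)))

  edge-of-adj : ∀ {x y} → A x y → Σ[ e ∈ Edge G ] (x ∈e e × y ∈e e)
  edge-of-adj {x} {y} r with <-cmp (toℕ x) (toℕ y)
  ... | tri< x<y _ _ = (x , y , x<y , r) , inj₁ refl , inj₂ refl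
  ... | tri≈ _ x≡y _ = ⊥-elim (irrefl G x (subst (A x) (sym (toℕ-injective x≡y)) r))
  ... | tri> _ _ y<x = (y , x , y<x , A-sym r) , inj₂ refl , inj₁ refl

  endpoints-equal-or-adj : ∀ {x z} e → x ∈e e → z ∈e e → x ≡ z ⊎ A x z
  endpoints-equal-or-adj _               (inj₁ refl) (inj₁ refl) = inj₁ refl
  endpoints-equal-or-adj (_ , _ , _ , r) (inj₁ refl) (inj₂ refl) = inj₂ r
  endpoints-equal-or-adj (_ , _ , _ , r) (inj₂ refl) (inj₁ refl) = inj₂ (A-sym r)
  endpoints-equal-or-adj _               (inj₂ refl) (inj₂ refl) = inj₁ refl

  subdivide : ∀ {x y m} → Walk A x y m → Walk S (inj₁ x) (inj₁ y) (double m)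
  subdivide nil        = nil
  subdivide (cons r w) with edge-of-adj r
  ... | e , x∈e , y∈e = cons {y = inj₂ e} x∈e (cons y∈e (subdivide w))

  contract : ∀ {x y k} → Walk S (inj₁ x) (inj₁ y) k → Σ[ m ∈ ℕ ] (Walk A x y m × double m ≤ k)
  contract nil = 0 , nil , z≤n
  contract (cons {y = inj₂ e} x∈e (cons {y = inj₁ z} z∈e w))
    with contract w | endpoints-equal-or-adj e x∈e z∈e
  ... | m , w′ , le | inj₁ refl = m , w′ , ≤-trans le (≤-trans (n≤1+n _) (n≤1+n _))
  ... | m , w′ , le | inj₂ r    = suc m , cons r w′ , s≤s (s≤s le)

  subdivide-IsDist : ∀ {x y d} → IsDist A x y d → IsDist S (inj₁ x) (inj₁ y) (double d)
  subdivide-IsDist (w , minimal) = subdivide w , λ k w′ →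
    let (m , wA , le) = contract w′ in ≤-trans (double-mono (minimal m wA)) le

  edge-neighbours : ∀ {i j i<j r w} → S (inj₂ (i , j , i<j , r)) w → w ≡ inj₁ i ⊎ w ≡ inj₁ j
  edge-neighbours {w = inj₁ _} (inj₁ refl) = inj₁ refl
  edge-neighbours {w = inj₁ _} (inj₂ refl) = inj₂ refl

  edge-vertex-IsDist : ∀ {i j i<j r x a b} → IsDist A i x a → IsDist A j x b →
                       IsDist S (inj₂ (i , j , i<j , r)) (inj₁ x) (suc (double a ⊓ double b))
  edge-vertex-IsDist di dj =
    IsDist-through-two-neighbours (inj₁ refl) (inj₂ refl) edge-neighbours (λ ())
      (subdivide-IsDist di) (subdivide-IsDist dj)

  edge-edge-IsDist : ∀ {a b a<b r f da db} → (a , b , a<b , r) ≢ f →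
                     IsDist S (inj₁ a) (inj₂ f) da → IsDist S (inj₁ b) (inj₂ f) db →
                     IsDist S (inj₂ (a , b , a<b , r)) (inj₂ f) (suc (da ⊓ db))
  edge-edge-IsDist e≢f =
    IsDist-through-two-neighbours (inj₁ refl) (inj₂ refl) edge-neighbours
      (λ { refl → e≢f refl })

  module _ (bipartite : Bipartite G) {D : ℕ}
           (dist : ∀ x y → ∃[ d ] (d ≤ D × IsDist A x y d)) where

    edge-vertex-dist : ∀ e x → ∃[ d ] (suc d ≤ double D × IsDist S (inj₂ e) (inj₁ x) d)
    edge-vertex-dist (i , j , _ , r) x with dist i x | dist j x
    ... | a , a≤D , di | b , b≤D , dj =
      _ , double-⊓-<-double a≤D b≤D a≢b , edge-vertex-IsDist di dj
      where
        a≢b : a ≢ b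
        a≢b refl = equal-length-walks⇒¬adjacent (proj₁ bipartite) (proj₂ bipartite _ _)
                     (proj₁ di) (proj₁ dj) r

    subdivision-dist : ∀ u v → ∃[ d ] (d ≤ double D × IsDist S u v d)
    subdivision-dist (inj₁ x) (inj₁ y) =
      let (d , d≤D , dxy) = dist x y in double d , double-mono d≤D , subdivide-IsDist dxy
    subdivision-dist (inj₂ e) (inj₁ x) =
      let (d , d<2D , dex) = edge-vertex-dist e x in d , ≤-trans (n≤1+n d) d<2D , dex
    subdivision-dist (inj₁ x) (inj₂ e) =
      let (d , d<2D , dex) = edge-vertex-dist e x in d , ≤-trans (n≤1+n d) d<2D , IsDist-sym S-sym dex
    subdivision-dist (inj₂ e@(a , b , _)) (inj₂ f) with e ≟E f
    ... | yes refl = 0 , z≤n , nil , λ _ _ → z≤n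
    ... | no e≢f with edge-vertex-dist f a | edge-vertex-dist f b
    ...   | da , da<2D , dfa | db , _ , dfb =
      _ , ≤-trans (s≤s (m⊓n≤m da db)) da<2D ,
      edge-edge-IsDist e≢f (IsDist-sym S-sym dfa) (IsDist-sym S-sym dfb)

lemma2p7 : (n : ℕ) (Σ : SimpleGraph n) → Connected (Adj Σ) → Bipartite Σ →
    (D : ℕ) → IsDiam (Adj Σ) D → IsDiam (SAdj Σ) (2 * D)
lemma2p7 n G _ bipartite D (dist , x , y , dxy) =
  subst (IsDiam (SAdj G)) (double≡2* D)
    (subdivision-dist bipartite dist , inj₁ x , inj₁ y , subdivide-IsDist dxy)
  where open Subdivision G
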